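{- Let $G$ be a subdivision of $K_5$ with branch vertices $a,b,c,d,e$ such that the four edges $ab,bc,cd,da$ of $K_5$ are not subdivided (they are edges of $G$) and each of the other six edges of $K_5$ is subdivided at least once (type A). Then $G$ is not a derived graph.
   Context: A subdivision of a graph is obtained by replacing some edges by paths of length at least $1$; an edge is subdivided if replaced by a path of length at least $2$. A Burling tree is a 4-tuple $(T,r,\mathrm{last},\mathrm{choose})$ where $T$ is a tree rooted at $r$; $\mathrm{last}$ assigns to every non-leaf vertex $v$ one of its children (its last-born); and $\mathrm{choose}$ assigns to every vertex $v$ that is neither the root nor a last-born the vertex set of a (possibly empty) downward branch of $T$ starting at the last-born of the parent of $v$, with $\mathrm{choose}(v)=\emptyset$ for the root and last-borns. The oriented graph fully derived from $T$ has vertex set $V(T)$ and arc $uv$ iff $v\in\mathrm{choose}(u)$. An oriented graph is derived if it is an induced subgraph of a graph fully derived from some Burling tree; a non-oriented graph is derived if it is the underlying graph of an oriented derived graph. -}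

module Defs where

open import Data.Nat using (ℕ; zero; suc; _<_; _≤_)
open import Data.Fin using (Fin; zero; suc; toℕ)
open import Data.Fin.Subset using (Subset; _∈_; _∉_)
open import Data.List using (List; []; _∷_; [_]; _++_; map; allFin)
open import Data.Product using (Σ; ∃; _×_; _,_)
open import Data.Sum using (_⊎_)
open import Relation.Binary.PropositionalEquality using (_≡_; _≢_)
open import Function.Definitions using (Injective)
open import Function.Bundles using (_⇔_)
import Data.Empty
import Data.List.Membership.Propositional

-- A finite tree T on vertex set Fin n, rooted at `root`, is given by a
-- parent function together with a depth function witnessing that
-- following parents from any vertex strictly decreases depth, hence
-- reaches the root (so the edges {v , parent v}, v ≢ root, form a tree).

ChildOf : ∀ {n} → Fin n → (Fin n → Fin n) → Fin n → Fin n → Set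
ChildOf root parent w v = (w ≢ root) × (parent w ≡ v)

data DownBranch {n} (root : Fin n) (parent : Fin n → Fin n) : Fin n → List (Fin n) → Set where
  single : ∀ w → DownBranch root parent w [ w ]
  cons   : ∀ {w w' xs} → ChildOf root parent w' w → DownBranch root parent w' xs →
           DownBranch root parent w (w ∷ xs)

record BurlingTree (n : ℕ) : Set where
  field
    root   : Fin n
    parent : Fin n → Fin n
    depth  : Fin n → ℕ
    depth-parent : ∀ v → v ≢ root → suc (depth (parent v)) ≡ depth v

  Child : Fin n → Fin n → Set
  Child = ChildOf root parent

  field
    last       : Fin n → Fin n
    last-child : ∀ v → (∃ λ w → Child w v) → Child (last v) v

  LastBorn : Fin n → Set
  LastBorn w = (w ≢ root) × (last (parent w) ≡ w)

  field
    choose : Fin n → Subset n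
    choose-root : ∀ x → x ∉ choose root
    choose-last : ∀ v → LastBorn v → ∀ x → x ∉ choose v
    choose-branch : ∀ v → v ≢ root → (LastBorn v → Data.Empty.⊥) →
      (∀ x → x ∉ choose v) ⊎
      (Σ (List (Fin n)) λ xs → DownBranch root parent (last (parent v)) xs ×
          (∀ x → (x ∈ choose v) ⇔ (x Data.List.Membership.Propositional.∈ xs)))

  -- arcs of the oriented graph fully derived from T
  Arc : Fin n → Fin n → Set
  Arc u v = v ∈ choose u

record Graph : Set₁ where
  field
    V   : Set
    Adj : V → V → Set

Derived : Graph → Set
Derived G = Σ ℕ λ n → Σ (BurlingTree n) λ T → Σ (Graph.V G → Fin n) λ f →
  Injective _≡_ _≡_ f ×
  (∀ x y → Graph.Adj G x y ⇔ (BurlingTree.Arc T (f x) (f y) ⊎ BurlingTree.Arc T (f y) (f x)))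

-- Branch vertices a,b,c,d,e are 0,1,2,3,4 : Fin 5.  The ten edges of K5
-- are indexed by Fin 10 via `ends`:
--   0:ab 1:bc 2:cd 3:da 4:ac 5:bd 6:ae 7:be 8:ce 9:de

a b c d e : Fin 5
a = zero
b = suc zero
c = suc (suc zero)
d = suc (suc (suc zero))
e = suc (suc (suc (suc zero)))

ends : Fin 10 → Fin 5 × Fin 5
ends zero = a , b
ends (suc zero) = b , c
ends (suc (suc zero)) = c , d
ends (suc (suc (suc zero))) = d , a
ends (suc (suc (suc (suc zero)))) = a , c
ends (suc (suc (suc (suc (suc zero))))) = b , d
ends (suc (suc (suc (suc (suc (suc zero)))))) = a , e
ends (suc (suc (suc (suc (suc (suc (suc zero))))))) = b , e
ends (suc (suc (suc (suc (suc (suc (suc (suc zero)))))))) = c , e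
ends (suc (suc (suc (suc (suc (suc (suc (suc (suc zero))))))))) = d , e

-- len k = number of internal (subdivision) vertices on edge k
data SV (len : Fin 10 → ℕ) : Set where
  br  : Fin 5 → SV len
  int : (k : Fin 10) → Fin (len k) → SV len

path : (len : Fin 10 → ℕ) → Fin 10 → List (SV len)
path len k with ends k
... | (u , v) = br u ∷ (map (int k) (allFin (len k)) ++ [ br v ])

data Consec {A : Set} : List A → A → A → Set where
  here  : ∀ {x y xs} → Consec (x ∷ y ∷ xs) x y
  there : ∀ {z x y xs} → Consec xs x y → Consec (z ∷ xs) x y

SubdivK5 : (Fin 10 → ℕ) → Graph
SubdivK5 len = record
  { V   = SV len
  ; Adj = λ x y → ∃ λ k → Consec (path len k) x y ⊎ Consec (path len k) y x
  }

TypeA : (Fin 10 → ℕ) → Set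
TypeA len = ∀ k → (toℕ k < 4 → len k ≡ 0) × (4 ≤ toℕ k → 1 ≤ len k)

{-# OPTIONS --safe #-}
-- In the oriented graph of a Burling tree, every out-neighbour of u lies below the last-born
-- sibling of u, and the out-neighbourhood of u is a downward branch.  Hence, walking along G,
-- whether a fixed vertex x is an ancestor of the current vertex can only change at x or at a
-- neighbour of x, so it is constant along walks avoiding the closed neighbourhood of x.  The unsubdivided square abcd is
-- a 4-cycle, which can only be oriented with one pair of opposite corners u, w pointing to both
-- corners s, t of the other pair, where s is an ancestor of t, say.  Walking along the
-- subdivided spokes towards e shows that s is an ancestor of e while t is not; consequently the
-- first vertices α, γ after u, w on their spokes are out-neighbours of u, w lying between s and
-- t.  As out-neighbourhoods are branches, u points to γ or w points to α, yet neither pair is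
-- adjacent in G.
module Submission where

open import Defs
open import Data.Nat using (ℕ; suc; _≤_; _<_; s≤s; z≤n)
open import Data.Nat.Properties using (≤-refl; ≤-trans; ≤-antisym; ≤-reflexive; n≤1+n; <-irrefl)
open import Data.Fin using (Fin; zero; suc; toℕ; #_)
open import Data.Fin.Properties using (_≟_)
import Data.Fin.Subset as Subset
open import Data.List using (List; []; _∷_; [_]; _++_; map; allFin)
open import Data.List.Membership.Propositional using (_∈_)
open import Data.List.Membership.Propositional.Properties using (∈-++⁻; ∈-map⁻)
open import Data.List.Relation.Unary.Any using (here; there)
open import Data.Product using (∃; _×_; _,_; proj₁; proj₂)
open import Data.Sum using (_⊎_; inj₁; inj₂; [_,_]′)
open import Data.Empty using (⊥; ⊥-elim)
open import Function using (_∘_)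
open import Function.Bundles using (_⇔_; Equivalence)
open import Function.Definitions using (Injective)
open import Relation.Binary.Construct.Closure.ReflexiveTransitive using (Star; ε; _◅_; reverse)
open import Relation.Nullary using (¬_; yes; no)
open import Relation.Binary.PropositionalEquality using (_≡_; _≢_; refl; sym; trans; cong; subst)

module Ancestry {n} (T : BurlingTree n) where
  open BurlingTree T

  infix 4 _≼_

  data _≼_ (x : Fin n) : Fin n → Set where
    ≼-refl : x ≼ x
    ≼-up   : ∀ {w} → w ≢ root → x ≼ parent w → x ≼ w

  ≼-trans : ∀ {x y z} → x ≼ y → y ≼ z → x ≼ z
  ≼-trans x≼y ≼-refl          = x≼y
  ≼-trans x≼y (≼-up w≢r y≼pw) = ≼-up w≢r (≼-trans x≼y y≼pw)

  ≼⇒depth≤ : ∀ {x w} → x ≼ w → depth x ≤ depth w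
  ≼⇒depth≤ ≼-refl = ≤-refl
  ≼⇒depth≤ {w = w} (≼-up w≢r x≼pw) =
    ≤-trans (≼⇒depth≤ x≼pw) (≤-trans (n≤1+n _) (≤-reflexive (depth-parent w w≢r)))

  ≺⇒depth< : ∀ {x w} → x ≼ w → x ≢ w → depth x < depth w
  ≺⇒depth< ≼-refl x≢w = ⊥-elim (x≢w refl)
  ≺⇒depth< {w = w} (≼-up w≢r x≼pw) _ = ≤-trans (s≤s (≼⇒depth≤ x≼pw)) (≤-reflexive (depth-parent w w≢r))

  ≼-depth-≡⇒≡ : ∀ {x w} → x ≼ w → depth x ≡ depth w → x ≡ w
  ≼-depth-≡⇒≡ {x} {w} x≼w eq with x ≟ w
  ... | yes x≡w = x≡w
  ... | no x≢w  = ⊥-elim (<-irrefl eq (≺⇒depth< x≼w x≢w))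

  ≼-antisym : ∀ {x y} → x ≼ y → y ≼ x → x ≡ y
  ≼-antisym x≼y y≼x = ≼-depth-≡⇒≡ x≼y (≤-antisym (≼⇒depth≤ x≼y) (≼⇒depth≤ y≼x))

  ancestors-comparable : ∀ {x y w} → x ≼ w → y ≼ w → x ≼ y ⊎ y ≼ x
  ancestors-comparable x≼w         ≼-refl        = inj₁ x≼w
  ancestors-comparable ≼-refl       y≼w           = inj₂ y≼w
  ancestors-comparable (≼-up _ x≼p) (≼-up _ y≼p) = ancestors-comparable x≼p y≼p

  ≺⇒≼parent : ∀ {x w} → x ≼ w → x ≢ w → w ≢ root × x ≼ parent w
  ≺⇒≼parent ≼-refl           x≢w = ⊥-elim (x≢w refl)
  ≺⇒≼parent (≼-up w≢r x≼pw) _   = w≢r , x≼pw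

  child⇒parent≼ : ∀ {w v} → Child w v → v ≼ w
  child⇒parent≼ (w≢r , refl) = ≼-up w≢r ≼-refl

  branch-head-≼ : ∀ {w xs y} → DownBranch root parent w xs → y ∈ xs → w ≼ y
  branch-head-≼ (single w)   (here refl) = ≼-refl
  branch-head-≼ (cons _ _)   (here refl) = ≼-refl
  branch-head-≼ (cons ch db) (there y∈) = ≼-trans (child⇒parent≼ ch) (branch-head-≼ db y∈)

  branch-comparable : ∀ {w xs y z} → DownBranch root parent w xs → y ∈ xs → z ∈ xs → y ≼ z ⊎ z ≼ y
  branch-comparable db@(single _) (here refl) z∈          = inj₁ (branch-head-≼ db z∈)
  branch-comparable db@(cons _ _) (here refl) z∈          = inj₁ (branch-head-≼ db z∈)
  branch-comparable db@(cons _ _) (there y∈)  (here refl) = inj₂ (branch-head-≼ db (there y∈))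
  branch-comparable (cons _ db)   (there y∈)  (there z∈)  = branch-comparable db y∈ z∈
  branch-comparable (single _)    (there ())  _

  branch-convex : ∀ {w xs z m} → DownBranch root parent w xs → z ∈ xs → w ≼ m → m ≼ z → m ∈ xs
  branch-convex (single _) (here refl) w≼m m≼w = here (≼-antisym m≼w w≼m)
  branch-convex (cons _ _) (here refl) w≼m m≼w = here (≼-antisym m≼w w≼m)
  branch-convex {w = w} {m = m} (cons {w' = w'} ch db) (there z∈) w≼m m≼z with m ≟ w
  ... | yes m≡w = here m≡w
  ... | no m≢w with ancestors-comparable (branch-head-≼ db z∈) m≼z
  ...   | inj₁ w'≼m = there (branch-convex db z∈ w'≼m m≼z)
  ...   | inj₂ m≼w' with m ≟ w'
  ...     | yes refl = there (branch-convex db z∈ ≼-refl m≼z)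
  ...     | no m≢w'  =
    ⊥-elim (m≢w (≼-antisym (subst (m ≼_) (proj₂ ch) (proj₂ (≺⇒≼parent m≼w' m≢w'))) w≼m))

  lastSibling : Fin n → Fin n
  lastSibling u = last (parent u)

  lastSibling-child : ∀ u → u ≢ root → Child (lastSibling u) (parent u)
  lastSibling-child u u≢r = last-child (parent u) (u , u≢r , refl)

  lastSibling-depth : ∀ u → u ≢ root → depth (lastSibling u) ≡ depth u
  lastSibling-depth u u≢r with lastSibling-child u u≢r
  ... | l≢r , pl≡pu = trans (sym (depth-parent (lastSibling u) l≢r))
                            (trans (cong (suc ∘ depth) pl≡pu) (depth-parent u u≢r))

  parent≼lastSibling : ∀ u → u ≢ root → parent u ≼ lastSibling u
  parent≼lastSibling u u≢r = child⇒parent≼ (lastSibling-child u u≢r)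

  record ArcSource (u : Fin n) : Set where
    field
      nonroot       : u ≢ root
      not-last-born : ¬ LastBorn u
      branch        : List (Fin n)
      branch-down   : DownBranch root parent (lastSibling u) branch
      chosen⇔branch : ∀ x → x Subset.∈ choose u ⇔ x ∈ branch

    chosen⇒branch : ∀ {x} → Arc u x → x ∈ branch
    chosen⇒branch {x} = Equivalence.to (chosen⇔branch x)

  arc-source : ∀ {u v} → Arc u v → ArcSource u
  arc-source {u} {v} u→v with u ≟ root
  ... | yes refl = ⊥-elim (choose-root v u→v)
  ... | no u≢r with choose-branch u u≢r (λ lb → choose-last u lb v u→v)
  ...   | inj₁ empty = ⊥-elim (empty v u→v)
  ...   | inj₂ (xs , db , iff) = record
    { nonroot = u≢r ; not-last-born = λ lb → choose-last u lb v u→v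
    ; branch = xs ; branch-down = db ; chosen⇔branch = iff }

  lastSibling≼target : ∀ {u v} → Arc u v → lastSibling u ≼ v
  lastSibling≼target u→v = branch-head-≼ branch-down (chosen⇒branch u→v)
    where open ArcSource (arc-source u→v)

  parent≼target : ∀ {u v} → Arc u v → parent u ≼ v
  parent≼target {u} u→v =
    ≼-trans (parent≼lastSibling u (ArcSource.nonroot (arc-source u→v))) (lastSibling≼target u→v)

  ≺-source⇒≼-target : ∀ {x u v} → x ≼ u → x ≢ u → Arc u v → x ≼ v
  ≺-source⇒≼-target x≼u x≢u u→v = ≼-trans (proj₂ (≺⇒≼parent x≼u x≢u)) (parent≼target u→v)

  arc-targets-comparable : ∀ {u v w} → Arc u v → Arc u w → v ≼ w ⊎ w ≼ v
  arc-targets-comparable u→v u→w = branch-comparable branch-down (chosen⇒branch u→v) (chosen⇒branch u→w)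
    where open ArcSource (arc-source u→v)

  arc-targets-convex : ∀ {u z m} → Arc u z → lastSibling u ≼ m → m ≼ z → Arc u m
  arc-targets-convex {m = m} u→z l≼m m≼z =
    Equivalence.from (chosen⇔branch m) (branch-convex branch-down (chosen⇒branch u→z) l≼m m≼z)
    where open ArcSource (arc-source u→z)

  below-lastSibling⇒incomparable : ∀ {u w} → u ≢ root → ¬ LastBorn u →
                                   lastSibling u ≼ w → ¬ u ≼ w × ¬ w ≼ u
  below-lastSibling⇒incomparable {u} {w} u≢r not-last l≼w =
    (λ u≼w → not-last (u≢r , sym (u≡lastSibling u≼w))) ,
    (λ w≼u → not-last (u≢r , ≼-depth-≡⇒≡ (≼-trans l≼w w≼u) (lastSibling-depth u u≢r)))
    where
    u≡lastSibling : u ≼ w → u ≡ lastSibling u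
    u≡lastSibling u≼w with ancestors-comparable u≼w l≼w
    ... | inj₁ u≼l = ≼-depth-≡⇒≡ u≼l (sym (lastSibling-depth u u≢r))
    ... | inj₂ l≼u = sym (≼-depth-≡⇒≡ l≼u (lastSibling-depth u u≢r))

  arc⇒incomparable : ∀ {u v} → Arc u v → ¬ u ≼ v × ¬ v ≼ u
  arc⇒incomparable u→v = below-lastSibling⇒incomparable nonroot not-last-born (lastSibling≼target u→v)
    where open ArcSource (arc-source u→v)

  arc-closed-below-lastSibling : ∀ {u v w} → u ≢ root → lastSibling u ≼ v → Arc v w → lastSibling u ≼ w
  arc-closed-below-lastSibling {u} {v} u≢r l≼v v→w with v ≟ lastSibling u
  ... | yes refl = ⊥-elim (ArcSource.not-last-born (arc-source v→w) (lastSibling-child u u≢r .proj₁ ,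
                     cong last (proj₂ (lastSibling-child u u≢r))))
  ... | no v≢l = ≺-source⇒≼-target l≼v (v≢l ∘ sym) v→w

  arc-arc⇒incomparable : ∀ {u v w} → Arc u v → Arc v w → ¬ u ≼ w × ¬ w ≼ u
  arc-arc⇒incomparable u→v v→w = below-lastSibling⇒incomparable nonroot not-last-born
    (arc-closed-below-lastSibling nonroot (lastSibling≼target u→v) v→w)
    where open ArcSource (arc-source u→v)

  no-directed-C4 : ∀ {x y z w} → Arc x y → Arc y z → Arc z w → Arc w x → ⊥
  no-directed-C4 {x} x→y y→z z→w w→x = proj₁ (below-lastSibling⇒incomparable nonroot not-last-born
    (closed (closed (closed (lastSibling≼target x→y) y→z) z→w) w→x)) ≼-refl
    where
    open ArcSource (arc-source x→y)
    closed : ∀ {v w} → lastSibling x ≼ v → Arc v w → lastSibling x ≼ w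
    closed = arc-closed-below-lastSibling nonroot

  no-common-target-below : ∀ {y w z} → y ≼ w → y ≢ w → Arc y z → ¬ Arc w z
  no-common-target-below y≼w y≢w y→z w→z = proj₁ (arc⇒incomparable y→z) (≺-source⇒≼-target y≼w y≢w w→z)

  no-arc-diamond : ∀ {u y w z} → Arc u y → Arc u w → Arc y z → Arc w z → y ≢ w → ⊥
  no-arc-diamond u→y u→w y→z w→z y≢w with arc-targets-comparable u→y u→w
  ... | inj₁ y≼w = no-common-target-below y≼w y≢w y→z w→z
  ... | inj₂ w≼y = no-common-target-below w≼y (y≢w ∘ sym) w→z y→z

  E : Fin n → Fin n → Set
  E u v = Arc u v ⊎ Arc v u

  E-sym : ∀ {u v} → E u v → E v u
  E-sym (inj₁ u→v) = inj₂ u→v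
  E-sym (inj₂ v→u) = inj₁ v→u

  no-C4-through-directed-P3 : ∀ {x y z w} → Arc x y → Arc y z → E z w → E w x → y ≢ w → ⊥
  no-C4-through-directed-P3 x→y y→z (inj₁ z→w) (inj₁ w→x) _ = no-directed-C4 x→y y→z z→w w→x
  no-C4-through-directed-P3 x→y y→z (inj₁ z→w) (inj₂ x→w) _ with arc-targets-comparable x→y x→w
  ... | inj₁ y≼w = proj₁ (arc-arc⇒incomparable y→z z→w) y≼w
  ... | inj₂ w≼y = proj₂ (arc-arc⇒incomparable y→z z→w) w≼y
  no-C4-through-directed-P3 x→y y→z (inj₂ w→z) (inj₂ x→w) y≢w = no-arc-diamond x→y x→w y→z w→z y≢w
  no-C4-through-directed-P3 x→y y→z (inj₂ w→z) (inj₁ w→x) _ with arc-targets-comparable w→x w→z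
  ... | inj₁ x≼z = proj₁ (arc-arc⇒incomparable x→y y→z) x≼z
  ... | inj₂ z≼x = proj₂ (arc-arc⇒incomparable x→y y→z) z≼x

  C4-orientation : ∀ {x₁ x₂ x₃ x₄} → E x₁ x₂ → E x₂ x₃ → E x₃ x₄ → E x₄ x₁ → x₁ ≢ x₃ → x₂ ≢ x₄ →
                   Arc x₁ x₂ × Arc x₁ x₄ × Arc x₃ x₂ × Arc x₃ x₄ ⊎
                   Arc x₂ x₁ × Arc x₄ x₁ × Arc x₂ x₃ × Arc x₄ x₃
  C4-orientation (inj₁ 1→2) (inj₁ 2→3) e₃₄ e₄₁ _ x₂≢x₄ =
    ⊥-elim (no-C4-through-directed-P3 1→2 2→3 e₃₄ e₄₁ x₂≢x₄)
  C4-orientation (inj₁ 1→2) (inj₂ 3→2) (inj₁ 3→4) (inj₂ 1→4) _ _ = inj₁ (1→2 , 1→4 , 3→2 , 3→4)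
  C4-orientation (inj₁ 1→2) (inj₂ 3→2) (inj₁ 3→4) (inj₁ 4→1) _ x₂≢x₄ =
    ⊥-elim (no-C4-through-directed-P3 3→4 4→1 (inj₁ 1→2) (inj₂ 3→2) (x₂≢x₄ ∘ sym))
  C4-orientation (inj₁ 1→2) (inj₂ 3→2) (inj₂ 4→3) e₄₁ x₁≢x₃ _ =
    ⊥-elim (no-C4-through-directed-P3 4→3 3→2 (inj₂ 1→2) (E-sym e₄₁) (x₁≢x₃ ∘ sym))
  C4-orientation (inj₂ 2→1) e₂₃ e₃₄ (inj₂ 1→4) x₁≢x₃ _ =
    ⊥-elim (no-C4-through-directed-P3 2→1 1→4 (E-sym e₃₄) (E-sym e₂₃) x₁≢x₃)
  C4-orientation (inj₂ 2→1) (inj₂ 3→2) e₃₄ (inj₁ 4→1) _ x₂≢x₄ =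
    ⊥-elim (no-C4-through-directed-P3 3→2 2→1 (inj₂ 4→1) (E-sym e₃₄) x₂≢x₄)
  C4-orientation (inj₂ 2→1) (inj₁ 2→3) (inj₂ 4→3) (inj₁ 4→1) _ _ = inj₂ (2→1 , 4→1 , 2→3 , 4→3)
  C4-orientation (inj₂ 2→1) (inj₁ 2→3) (inj₁ 3→4) (inj₁ 4→1) _ x₂≢x₄ =
    ⊥-elim (no-C4-through-directed-P3 3→4 4→1 (inj₂ 2→1) (inj₁ 2→3) (x₂≢x₄ ∘ sym))

  ≼-across-edge : ∀ {x w z} → x ≼ w → E z w → x ≼ z ⊎ w ≡ x ⊎ Arc z x
  ≼-across-edge {x} {w} x≼w (inj₂ w→z) with w ≟ x
  ... | yes w≡x = inj₂ (inj₁ w≡x)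
  ... | no w≢x  = inj₁ (≺-source⇒≼-target x≼w (w≢x ∘ sym) w→z)
  ≼-across-edge {x} {z = z} x≼w (inj₁ z→w) with ancestors-comparable (lastSibling≼target z→w) x≼w
  ... | inj₁ l≼x = inj₂ (inj₂ (arc-targets-convex z→w l≼x x≼w))
  ... | inj₂ x≼l with x ≟ lastSibling z
  ...   | yes refl = inj₂ (inj₂ (arc-targets-convex z→w ≼-refl x≼w))
  ...   | no x≢l   =
    inj₁ (≼-up z≢r (subst (x ≼_) (proj₂ (lastSibling-child z z≢r)) (proj₂ (≺⇒≼parent x≼l x≢l))))
    where z≢r = ArcSource.nonroot (arc-source z→w)

module _ {A : Set} where

  consec-∈ˡ : ∀ {xs : List A} {x y} → Consec xs x y → x ∈ xs
  consec-∈ˡ here      = here refl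
  consec-∈ˡ (there c) = there (consec-∈ˡ c)

  consec-∈ʳ : ∀ {xs : List A} {x y} → Consec xs x y → y ∈ xs
  consec-∈ʳ here      = there (here refl)
  consec-∈ʳ (there c) = there (consec-∈ʳ c)

  second-element : ∀ (x : A) xs z → ∃ λ y → y ∈ xs ++ [ z ] × Consec (x ∷ xs ++ [ z ]) x y
  second-element x []      z = z , here refl , here
  second-element x (y ∷ _) z = y , here refl , here

  linked⇒star-to-last : ∀ {R : A → A → Set} xs {z y} → (∀ {u v} → Consec (xs ++ [ z ]) u v → R u v) →
                        y ∈ xs ++ [ z ] → Star R y z
  linked⇒star-to-last []            _      (here refl) = ε
  linked⇒star-to-last (x ∷ [])      linked (here refl) = linked here ◅ ε
  linked⇒star-to-last (x ∷ x′ ∷ xs) linked (here refl) =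
    linked here ◅ linked⇒star-to-last (x′ ∷ xs) (linked ∘ there) (here refl)
  linked⇒star-to-last (x ∷ xs)      linked (there y∈)  = linked⇒star-to-last xs (linked ∘ there) y∈

module Walks (G : Graph) where
  open Graph G

  infix 4 _∉N[_]

  _∉N[_] : V → V → Set
  y ∉N[ X ] = y ≢ X × ¬ Adj y X

  Step : V → V → V → Set
  Step X y z = y ∉N[ X ] × z ∉N[ X ] × Adj y z

  Route : V → V → V → Set
  Route X = Star (Step X)

  route-along : ∀ {X z} xs → (∀ {y} → y ∈ xs ++ [ z ] → y ∉N[ X ]) →
                (∀ {u v} → Consec (xs ++ [ z ]) u v → Adj u v) → ∀ {y} → y ∈ xs ++ [ z ] → Route X y z
  route-along xs outside adjacent =
    linked⇒star-to-last xs (λ c → outside (consec-∈ˡ c) , outside (consec-∈ʳ c) , adjacent c)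

  -- In a type-A subdivision, u and w are opposite corners and vertex follows u on its spoke to e.
  record Exit (u w s t e : V) : Set where
    field
      vertex           : V
      adjacent         : Adj u vertex
      outside-s        : vertex ∉N[ s ]
      outside-t        : vertex ∉N[ t ]
      outside-w        : vertex ∉N[ w ]
      route-avoiding-s : Route s vertex e
      route-avoiding-t : Route t vertex e

  Exit-swap : ∀ {u w s t e} → Exit u w s t e → Exit u w t s e
  Exit-swap ex = record
    { vertex = vertex ; adjacent = adjacent
    ; outside-s = outside-t ; outside-t = outside-s ; outside-w = outside-w
    ; route-avoiding-s = route-avoiding-t ; route-avoiding-t = route-avoiding-s }
    where open Exit ex

  record Crossing (u w s t e : V) : Set where
    field
      s≢t          : s ≢ t
      route-from-t : Route s t e
      route-from-s : Route t s e
      exit-u       : Exit u w s t e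
      exit-w       : Exit w u s t e

  Crossing-swap : ∀ {u w s t e} → Crossing u w s t e → Crossing u w t s e
  Crossing-swap cr = record
    { s≢t = s≢t ∘ sym ; route-from-t = route-from-s ; route-from-s = route-from-t
    ; exit-u = Exit-swap exit-u ; exit-w = Exit-swap exit-w }
    where open Crossing cr

module Embedding {G : Graph} {n} (T : BurlingTree n) (f : Graph.V G → Fin n)
  (f-inj : Injective _≡_ _≡_ f)
  (f-adj : ∀ x y → Graph.Adj G x y ⇔ (BurlingTree.Arc T (f x) (f y) ⊎ BurlingTree.Arc T (f y) (f x))) where
  open Graph G
  open BurlingTree T using (Arc)
  open Ancestry T
  open Walks G

  adj⇒E : ∀ {x y} → Adj x y → E (f x) (f y)
  adj⇒E {x} {y} = Equivalence.to (f-adj x y)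

  E⇒adj : ∀ {x y} → E (f x) (f y) → Adj x y
  E⇒adj {x} {y} = Equivalence.from (f-adj x y)

  Step-sym : ∀ {X y z} → Step X y z → Step X z y
  Step-sym (y∉ , z∉ , y~z) = z∉ , y∉ , E⇒adj (E-sym (adj⇒E y~z))

  ≼-step : ∀ {X y z} → Step X y z → f X ≼ f y → f X ≼ f z
  ≼-step (y∉ , z∉ , y~z) X≼y with ≼-across-edge X≼y (E-sym (adj⇒E y~z))
  ... | inj₁ X≼z          = X≼z
  ... | inj₂ (inj₁ fy≡fX) = ⊥-elim (proj₁ y∉ (f-inj fy≡fX))
  ... | inj₂ (inj₂ z→X)   = ⊥-elim (proj₂ z∉ (E⇒adj (inj₁ z→X)))

  ≼-along : ∀ {X y z} → Route X y z → f X ≼ f y → f X ≼ f z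
  ≼-along ε         X≼y = X≼y
  ≼-along (st ◅ rt) X≼y = ≼-along rt (≼-step st X≼y)

  ≼-along-backwards : ∀ {X y z} → Route X y z → f X ≼ f z → f X ≼ f y
  ≼-along-backwards rt = ≼-along (reverse Step-sym rt)

  exit-target-below : ∀ {u w s t e} → (ex : Exit u w s t e) → f s ≼ f e → ¬ f t ≼ f e →
                      Arc (f u) (f s) → Arc (f u) (f t) →
                      Arc (f u) (f (Exit.vertex ex)) × f (Exit.vertex ex) ≼ f t
  exit-target-below {u} {s = s} {t} ex s≼e t⋠e u→s u→t = u→α , α≼t
    where
    open Exit ex renaming (vertex to α)
    s≼α : f s ≼ f α
    s≼α = ≼-along-backwards route-avoiding-s s≼e
    u→α : Arc (f u) (f α)
    u→α with adj⇒E adjacent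
    ... | inj₁ u→α = u→α
    ... | inj₂ α→u = ⊥-elim (proj₂ (arc⇒incomparable u→s)
                      (≺-source⇒≼-target s≼α (λ fs≡fα → proj₁ outside-s (f-inj (sym fs≡fα))) α→u))
    α≼t : f α ≼ f t
    α≼t with arc-targets-comparable u→α u→t
    ... | inj₁ α≼t = α≼t
    ... | inj₂ t≼α = ⊥-elim (t⋠e (≼-along route-avoiding-t t≼α))

  between-arc-targets⇒adjacent : ∀ {u α γ t} → Arc (f u) (f α) → Arc (f u) (f t) →
                                 f α ≼ f γ → f γ ≼ f t → Adj γ u
  between-arc-targets⇒adjacent u→α u→t α≼γ γ≼t =
    E⇒adj (inj₂ (arc-targets-convex u→t (≼-trans (lastSibling≼target u→α) α≼γ) γ≼t))

  open Crossing using (exit-u; exit-w)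

  crossing-ancestry : ∀ {u w s t e} → Crossing u w s t e → f s ≼ f t → f s ≼ f e × ¬ f t ≼ f e
  crossing-ancestry cr s≼t =
    ≼-along route-from-t s≼t ,
    λ t≼e → s≢t (f-inj (≼-antisym s≼t (≼-along-backwards route-from-s t≼e)))
    where open Crossing cr

  ordered-crossing-impossible : ∀ {u w s t e} → Crossing u w s t e → f s ≼ f t →
    Arc (f u) (f s) → Arc (f u) (f t) → Arc (f w) (f s) → Arc (f w) (f t) → ⊥
  ordered-crossing-impossible cr s≼t u→s u→t w→s w→t with crossing-ancestry cr s≼t
  ... | s≼e , t⋠e with exit-target-below (exit-u cr) s≼e t⋠e u→s u→t
                    | exit-target-below (exit-w cr) s≼e t⋠e w→s w→t
  ...   | u→α , α≼t | w→γ , γ≼t with ancestors-comparable α≼t γ≼t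
  ...     | inj₁ α≼γ = proj₂ (Exit.outside-w (exit-w cr)) (between-arc-targets⇒adjacent u→α u→t α≼γ γ≼t)
  ...     | inj₂ γ≼α = proj₂ (Exit.outside-w (exit-u cr)) (between-arc-targets⇒adjacent w→γ w→t γ≼α α≼t)

  crossing-impossible : ∀ {u w s t e} → Crossing u w s t e →
    Arc (f u) (f s) → Arc (f u) (f t) → Arc (f w) (f s) → Arc (f w) (f t) → ⊥
  crossing-impossible cr u→s u→t w→s w→t with arc-targets-comparable u→s u→t
  ... | inj₁ s≼t = ordered-crossing-impossible cr s≼t u→s u→t w→s w→t
  ... | inj₂ t≼s = ordered-crossing-impossible (Crossing-swap cr) t≼s u→t u→s w→t w→s

  crossed-square-impossible : ∀ {x₁ x₂ x₃ x₄ e} → Adj x₁ x₂ → Adj x₂ x₃ → Adj x₃ x₄ → Adj x₄ x₁ →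
                              Crossing x₁ x₃ x₂ x₄ e → Crossing x₂ x₄ x₁ x₃ e → ⊥
  crossed-square-impossible x₁~x₂ x₂~x₃ x₃~x₄ x₄~x₁ cr₁₃ cr₂₄
    with C4-orientation (adj⇒E x₁~x₂) (adj⇒E x₂~x₃) (adj⇒E x₃~x₄) (adj⇒E x₄~x₁)
                        (Crossing.s≢t cr₂₄ ∘ f-inj) (Crossing.s≢t cr₁₃ ∘ f-inj)
  ... | inj₁ (1→2 , 1→4 , 3→2 , 3→4) = crossing-impossible cr₁₃ 1→2 1→4 3→2 3→4
  ... | inj₂ (2→1 , 4→1 , 2→3 , 4→3) = crossing-impossible cr₂₄ 2→1 2→3 4→1 4→3

data SquareSide : Fin 5 → Fin 5 → Set where
  ab : SquareSide a b
  bc : SquareSide b c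
  cd : SquareSide c d
  da : SquareSide d a

module SubdivisionK5 (len : Fin 10 → ℕ) where
  open Graph (SubdivK5 len) using (Adj)
  open Walks (SubdivK5 len)

  end₁ end₂ : Fin 10 → Fin 5
  end₁ k = proj₁ (ends k)
  end₂ k = proj₂ (ends k)

  interior : Fin 10 → List (SV len)
  interior k = map (int k) (allFin (len k))

  path-shape : ∀ k → path len k ≡ br (end₁ k) ∷ interior k ++ [ br (end₂ k) ]
  path-shape k with ends k
  ... | _ = refl

  along-path⇒adj : ∀ k {x y} → Consec (br (end₁ k) ∷ interior k ++ [ br (end₂ k) ]) x y → Adj x y
  along-path⇒adj k {x} {y} c = k , inj₁ (subst (λ P → Consec P x y) (sym (path-shape k)) c)

  module _ {k : Fin 10} {q : Fin 5} where

    tail-¬br-first : ∀ is {X y} → ¬ Consec (map (int {len} k) is ++ [ br q ]) (br X) y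
    tail-¬br-first []       (there ())
    tail-¬br-first (_ ∷ is) (there c) = tail-¬br-first is c

    tail-int-br : ∀ is {k′ i X} → Consec (map (int {len} k) is ++ [ br q ]) (int k′ i) (br X) →
                  k′ ≡ k × X ≡ q
    tail-int-br []       (there ())
    tail-int-br (_ ∷ []) here      = refl , refl
    tail-int-br (_ ∷ is) (there c) = tail-int-br is c

    module _ {p : Fin 5} where

      path-int-br : ∀ is {k′ i X} → Consec (br p ∷ map (int {len} k) is ++ [ br q ]) (int k′ i) (br X) →
                    k′ ≡ k × X ≡ q
      path-int-br is (there c) = tail-int-br is c

      path-br-int : ∀ is {k′ i X} → Consec (br p ∷ map (int {len} k) is ++ [ br q ]) (br X) (int k′ i) →
                    k′ ≡ k × X ≡ p
      path-br-int (_ ∷ _) here      = refl , refl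
      path-br-int is      (there c) = ⊥-elim (tail-¬br-first is c)

      path-br-br : ∀ is {p′ q′} → Consec (br p ∷ map (int {len} k) is ++ [ br q ]) (br p′) (br q′) →
                   is ≡ [] × p′ ≡ p × q′ ≡ q
      path-br-br []  here      = refl , refl , refl
      path-br-br is  (there c) = ⊥-elim (tail-¬br-first is c)

  on-path : ∀ {k x y} → Consec (path len k) x y →
            Consec (br (end₁ k) ∷ interior k ++ [ br (end₂ k) ]) x y
  on-path {k} {x} {y} = subst (λ P → Consec P x y) (path-shape k)

  int-adj-br : ∀ {k i X} → Adj (int k i) (br X) → X ≡ end₁ k ⊎ X ≡ end₂ k
  int-adj-br (k , inj₁ c) with path-int-br (allFin (len k)) (on-path c)
  ... | refl , X≡q = inj₂ X≡q
  int-adj-br (k , inj₂ c) with path-br-int (allFin (len k)) (on-path c)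
  ... | refl , X≡p = inj₁ X≡p

  allFin-nonempty : ∀ {m} → 1 ≤ m → allFin m ≢ []
  allFin-nonempty {suc _} _ ()

  unsubdivided⇒side : TypeA len → ∀ k → allFin (len k) ≡ [] → SquareSide (end₁ k) (end₂ k)
  unsubdivided⇒side _ zero                   _ = ab
  unsubdivided⇒side _ (suc zero)             _ = bc
  unsubdivided⇒side _ (suc (suc zero))       _ = cd
  unsubdivided⇒side _ (suc (suc (suc zero))) _ = da
  unsubdivided⇒side typeA k@(suc (suc (suc (suc _)))) empty =
    ⊥-elim (allFin-nonempty (proj₂ (typeA k) (s≤s (s≤s (s≤s (s≤s z≤n))))) empty)

  br-adj-br : TypeA len → ∀ {p q} → Adj (br p) (br q) → SquareSide p q ⊎ SquareSide q p
  br-adj-br typeA (k , inj₁ c) with path-br-br (allFin (len k)) (on-path c)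
  ... | empty , refl , refl = inj₁ (unsubdivided⇒side typeA k empty)
  br-adj-br typeA (k , inj₂ c) with path-br-br (allFin (len k)) (on-path c)
  ... | empty , refl , refl = inj₂ (unsubdivided⇒side typeA k empty)

  unsubdivided-adjacent : ∀ k → len k ≡ 0 → Adj (br (end₁ k)) (br (end₂ k))
  unsubdivided-adjacent k len≡0 = along-path⇒adj k (ends-consecutive (len k) (int k) len≡0)
    where
    ends-consecutive : ∀ {x y : SV len} m (g : Fin m → SV len) → m ≡ 0 →
                       Consec (x ∷ map g (allFin m) ++ [ y ]) x y
    ends-consecutive _ _ refl = here

  square-sides-adjacent : TypeA len →
                          Adj (br a) (br b) × Adj (br b) (br c) × Adj (br c) (br d) × Adj (br d) (br a)
  square-sides-adjacent typeA = side (# 0) (s≤s z≤n) , side (# 1) (s≤s (s≤s z≤n)) ,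
                                side (# 2) (s≤s (s≤s (s≤s z≤n))) , side (# 3) (s≤s (s≤s (s≤s (s≤s z≤n))))
    where
    side : ∀ k → toℕ k < 4 → Adj (br (end₁ k)) (br (end₂ k))
    side k k<4 = unsubdivided-adjacent k (proj₁ (typeA k) k<4)

  branch-∉N : TypeA len → ∀ {p q} → p ≢ q → ¬ SquareSide p q → ¬ SquareSide q p → br p ∉N[ br q ]
  branch-∉N typeA p≢q ¬pq ¬qp =
    (λ { refl → p≢q refl }) , λ adj → [ ¬pq , ¬qp ]′ (br-adj-br typeA adj)

  interior-∉N : ∀ {k i X} → X ≢ end₁ k → X ≢ end₂ k → int k i ∉N[ br X ]
  interior-∉N X≢p X≢q = (λ ()) , λ adj → [ X≢p , X≢q ]′ (int-adj-br adj)

  tail-∉N : ∀ {k X y} → X ≢ end₁ k → br (end₂ k) ∉N[ br X ] →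
            y ∈ interior k ++ [ br (end₂ k) ] → y ∉N[ br X ]
  tail-∉N {k} X≢p q∉ y∈ with ∈-++⁻ (interior k) y∈
  ... | inj₁ y∈int with ∈-map⁻ (int k) y∈int
  ...   | _ , _ , refl = interior-∉N X≢p (λ { refl → proj₁ q∉ refl })
  tail-∉N X≢p q∉ y∈ | inj₂ (here refl) = q∉

  edge-route : ∀ k {X} → br (end₁ k) ∉N[ br X ] → br (end₂ k) ∉N[ br X ] →
               Route (br X) (br (end₁ k)) (br (end₂ k))
  edge-route k p∉ q∉ = route-along (br (end₁ k) ∷ interior k) outside (along-path⇒adj k) (here refl)
    where
    outside : ∀ {y} → y ∈ br (end₁ k) ∷ interior k ++ [ br (end₂ k) ] → y ∉N[ br _ ]
    outside (here refl) = p∉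
    outside (there y∈)  = tail-∉N (λ { refl → proj₁ p∉ refl }) q∉ y∈

  edge-exit : ∀ k {w s t} → s ≢ end₁ k → t ≢ end₁ k → w ≢ end₁ k →
              br (end₂ k) ∉N[ br s ] → br (end₂ k) ∉N[ br t ] → br (end₂ k) ∉N[ br w ] →
              Exit (br (end₁ k)) (br w) (br s) (br t) (br (end₂ k))
  edge-exit k s≢p t≢p w≢p q∉s q∉t q∉w with second-element (br (end₁ k)) (interior k) (br (end₂ k))
  ... | α , α∈ , p-α = record
    { vertex = α ; adjacent = along-path⇒adj k p-α
    ; outside-s = tail-∉N s≢p q∉s α∈ ; outside-t = tail-∉N t≢p q∉t α∈ ; outside-w = tail-∉N w≢p q∉w α∈
    ; route-avoiding-s = route-along (interior k) (tail-∉N s≢p q∉s) (along-path⇒adj k ∘ there) α∈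
    ; route-avoiding-t = route-along (interior k) (tail-∉N t≢p q∉t) (along-path⇒adj k ∘ there) α∈ }

  e-∉N : TypeA len → ∀ {p} → p ≢ e → br e ∉N[ br p ]
  e-∉N typeA p≢e = branch-∉N typeA (λ { refl → p≢e refl }) (λ ()) (λ ())

  crossing-ac-bd : TypeA len → Crossing (br a) (br c) (br b) (br d) (br e)
  crossing-ac-bd typeA = record
    { s≢t          = λ ()
    ; route-from-t = edge-route (# 9) (branch-∉N typeA (λ ()) (λ ()) (λ ())) (e-∉N typeA (λ ()))
    ; route-from-s = edge-route (# 7) (branch-∉N typeA (λ ()) (λ ()) (λ ())) (e-∉N typeA (λ ()))
    ; exit-u = edge-exit (# 6) (λ ()) (λ ()) (λ ())
                 (e-∉N typeA (λ ())) (e-∉N typeA (λ ())) (e-∉N typeA (λ ()))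
    ; exit-w = edge-exit (# 8) (λ ()) (λ ()) (λ ())
                 (e-∉N typeA (λ ())) (e-∉N typeA (λ ())) (e-∉N typeA (λ ()))
    }

  crossing-bd-ac : TypeA len → Crossing (br b) (br d) (br a) (br c) (br e)
  crossing-bd-ac typeA = record
    { s≢t          = λ ()
    ; route-from-t = edge-route (# 8) (branch-∉N typeA (λ ()) (λ ()) (λ ())) (e-∉N typeA (λ ()))
    ; route-from-s = edge-route (# 6) (branch-∉N typeA (λ ()) (λ ()) (λ ())) (e-∉N typeA (λ ()))
    ; exit-u = edge-exit (# 7) (λ ()) (λ ()) (λ ())
                 (e-∉N typeA (λ ())) (e-∉N typeA (λ ())) (e-∉N typeA (λ ()))
    ; exit-w = edge-exit (# 9) (λ ()) (λ ()) (λ ())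
                 (e-∉N typeA (λ ())) (e-∉N typeA (λ ())) (e-∉N typeA (λ ()))
    }

mainTheorem10 : (len : Fin 10 → ℕ) → TypeA len → ¬ Derived (SubdivK5 len)
mainTheorem10 len typeA (n , T , f , f-inj , f-adj) =
  let a~b , b~c , c~d , d~a = square-sides-adjacent typeA
  in  crossed-square-impossible a~b b~c c~d d~a (crossing-ac-bd typeA) (crossing-bd-ac typeA)
  where
  open Embedding T f f-inj f-adj
  open SubdivisionK5 len
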